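{- In the setting below, for every stack configuration $\rho$ and every $v\in V_0$: $E_v^-E_v^+\rho\equiv\rho$; the path traversed by the antiparticle added at $v$ to $E_v^+\rho$ (until it reaches $T$) is the loop-erasure of the path traversed by the particle added at $v$ to $\rho$ (until it reaches $T$); in particular $t_v^-(E_v^+\rho)=t_v^+(\rho)$.
   Context: $G=(V,E)$ is a finite strongly connected directed graph, $T\subseteq V$ a nonempty set of targets, $V_0=V\setminus T$, $d(v)$ the out-degree. A stack configuration $\rho$ assigns to each $v\in V_0$ a bi-infinite sequence $\rho_v=(a^v_i)_{i\in\mathbb{Z}}$ of arcs leaving $v$, periodic with period $d(v)$, such that $a^v_1,\dots,a^v_{d(v)}$ are the $d(v)$ distinct arcs leaving $v$ (pictured $[\dots,a_0\,|\,a_1,\dots]$). Popping the stack at $v$ replaces $(a_i)$ by $(a_{i+1})_i$; pushing replaces it by $(a_{i-1})_i$. A particle step at $v$: pop the stack at $v$, then the particle moves along the new $a^v_0$. An antiparticle step at $v$: the antiparticle moves along the current $a^v_0$, then the stack at $v$ is pushed. Particles and antiparticles stop on reaching $T$. $E_v^+\rho$ (resp. $E_v^-\rho$) is the stack configuration after adding one particle (resp. antiparticle) at $v$ and letting it step until it reaches $T$; $t_v^\pm(\rho)$ is the target where it stops. A particle configuration is $\sigma:V_0\to\mathbb{N}$; $\sigma\rho$ is obtained by placing $\sigma(v)$ particles at each $v$ and letting all take particle steps until each reaches $T$ (independent of order); $\rho\equiv\rho'$ means $\sigma\rho=\sigma\rho'$ for some $\sigma$. Loop-erasure of a path $(x_0,\dots,x_r)$: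 if it contains a sub-path $(x_p,\dots,x_q)$ with $x_q=x_p$, $p<q$, take such with $q$ minimal and replace the path by $(x_0,\dots,x_p,x_{q+1},\dots,x_r)$; repeat until no vertex repeats; the resulting simple path from $x_0$ to $x_r$ is the loop-erasure. -}

module Defs where

open import Data.Nat using (ℕ; zero; suc)
open import Data.Integer as ℤ using (ℤ; +_)
open import Data.Fin using (Fin)
open import Data.Fin.Properties using (_≟_)
open import Data.Bool using (Bool; true; false)
open import Data.List using (List; []; _∷_; _++_; length; filter; allFin)
open import Data.List.Relation.Unary.Unique.Propositional using (Unique)
open import Data.Product using (Σ; ∃; _×_; _,_)
open import Relation.Nullary using (yes; no)
open import Relation.Binary.PropositionalEquality using (_≡_)
open import Relation.Binary.Construct.Closure.ReflexiveTransitive using (Star)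

record Setting : Set where
  field
    n m    : ℕ
    src    : Fin m → Fin n
    tgt    : Fin m → Fin n
    isT    : Fin n → Bool
  Edge : Fin n → Fin n → Set
  Edge u w = ∃ λ a → src a ≡ u × tgt a ≡ w
  field
    strongly-connected : ∀ u w → Star Edge u w
    T-nonempty         : ∃ λ t → isT t ≡ true

module _ (S : Setting) where
  open Setting S

  Vertex : Set
  Vertex = Fin n

  Arc : Set
  Arc = Fin m

  InV₀ : Vertex → Set
  InV₀ v = isT v ≡ false

  outdeg : Vertex → ℕ
  outdeg v = length (filter (λ a → src a ≟ v) (allFin m))

  -- raw stacks: a bi-infinite sequence of arcs at every vertex
  -- (the sequences at target vertices are irrelevant)
  Config : Set
  Config = Vertex → ℤ → Arc

  IsStackConfig : Config → Set
  IsStackConfig ρ = ∀ v → InV₀ v →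
      (∀ i → ρ v (i ℤ.+ + outdeg v) ≡ ρ v i)
    × (∀ (k : ℕ) → 1 Data.Nat.≤ k → k Data.Nat.≤ outdeg v → src (ρ v (+ k)) ≡ v)
    × (∀ (k l : ℕ) → 1 Data.Nat.≤ k → k Data.Nat.≤ outdeg v → 1 Data.Nat.≤ l → l Data.Nat.≤ outdeg v →
          ρ v (+ k) ≡ ρ v (+ l) → k ≡ l)
    × (∀ a → src a ≡ v → Σ ℕ λ k → 1 Data.Nat.≤ k × k Data.Nat.≤ outdeg v × ρ v (+ k) ≡ a)

  pop : Vertex → Config → Config
  pop v ρ w i with w ≟ v
  ... | yes _ = ρ w (i ℤ.+ + 1)
  ... | no  _ = ρ w i

  push : Vertex → Config → Config
  push v ρ w i with w ≟ v
  ... | yes _ = ρ w (i ℤ.- + 1)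
  ... | no  _ = ρ w i

  -- PRun ρ v p ρ' : a particle added at v to ρ traverses the path p
  -- (list of visited vertices, from v to the target where it stops)
  -- and leaves the stack configuration ρ'.
  data PRun : Config → Vertex → List Vertex → Config → Set where
    stop : ∀ {ρ v} → isT v ≡ true → PRun ρ v (v ∷ []) ρ
    step : ∀ {ρ v p ρ'} → InV₀ v →
           PRun (pop v ρ) (tgt (pop v ρ v (+ 0))) p ρ' →
           PRun ρ v (v ∷ p) ρ'

  data ARun : Config → Vertex → List Vertex → Config → Set where
    stop : ∀ {ρ v} → isT v ≡ true → ARun ρ v (v ∷ []) ρ
    step : ∀ {ρ v p ρ'} → InV₀ v →
           ARun (push v ρ) (tgt (ρ v (+ 0))) p ρ' →
           ARun ρ v (v ∷ p) ρ'

  -- particle configurations σ (values on T are ignored)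
  PConfig : Set
  PConfig = Vertex → ℕ

  setAt : Vertex → ℕ → PConfig → PConfig
  setAt v k σ w with w ≟ v
  ... | yes _ = k
  ... | no  _ = σ w

  addOne : Vertex → PConfig → PConfig
  addOne v σ w with w ≟ v
  ... | yes _ = suc (σ w)
  ... | no  _ = σ w

  -- Fire σ ρ ρ' : placing σ(v) particles at each v ∈ V₀ on ρ and letting them
  -- take particle steps (in some order) until all reach T yields ρ'.
  -- (σρ is independent of the order, so this relation describes σρ.)
  data Fire : PConfig → Config → Config → Set where
    done : ∀ {σ ρ} → (∀ v → InV₀ v → σ v ≡ 0) → Fire σ ρ ρ
    step : ∀ {σ ρ ρ'} v k → InV₀ v → σ v ≡ suc k →
           Fire (addOne (tgt (pop v ρ v (+ 0))) (setAt v k σ)) (pop v ρ) ρ' →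
           Fire σ ρ ρ'

  _≐_ : Config → Config → Set
  ρ ≐ ρ' = ∀ v → InV₀ v → ∀ i → ρ v i ≡ ρ' v i

  -- ρ ≡ ρ' in the paper: σρ = σρ' for some σ
  _≈ₛ_ : Config → Config → Set
  ρ ≈ₛ ρ' = Σ PConfig λ σ → Σ Config λ R → Σ Config λ R' →
              Fire σ ρ R × Fire σ ρ' R' × R ≐ R'

-- One erasure step: the path is  pre ++ y ∷ mid ++ y ∷ post
-- where (pre ++ y ∷ mid) has no repeated vertex (so q = |pre|+1+|mid| is the
-- minimal index closing a loop, p = |pre|); replace it by pre ++ y ∷ post.
data LEStep {A : Set} : List A → List A → Set where
  erase : ∀ pre y mid post → Unique (pre ++ y ∷ mid) →
          LEStep (pre ++ y ∷ mid ++ y ∷ post) (pre ++ y ∷ post)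

LoopErasure : {A : Set} → List A → List A → Set
LoopErasure xs ys = Star LEStep xs ys × Unique ys

-- A particle run can be loop-erased on the fly: keep the loop-free history of
-- visited vertices, and when the particle returns to a vertex of the history,
-- cut the history back to that vertex.  Invariant: at every vertex of the
-- history the top arc of the current stack points to the next vertex of the
-- history.  (A vertex left for the last time keeps its last popped arc on
-- top, and cutting a loop only shortens the history.)  So when the particle
-- stops, the final stacks point along the loop-erasure of its path.  An
-- antiparticle then follows exactly that loop-erased path, pushing each of its
-- vertices once, and a single particle added at v retraces it, popping the
-- same vertices back to E⁺ρ.  So one particle at v takes both ρ and E⁻E⁺ρ to
-- E⁺ρ.
module Submission where

open import Defs
open import Data.Nat using (suc)
open import Data.Integer as ℤ using (+_)
import Data.Integer.Properties as ℤ
open import Data.Fin.Properties using (_≟_)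
open import Data.Bool using (true)
open import Data.Product using (Σ; ∃; _×_; _,_; proj₁; proj₂)
open import Data.Empty using (⊥-elim)
open import Data.Maybe using (just)
open import Data.Maybe.Properties using (just-injective)
open import Data.List using (List; []; _∷_; _++_; _∷ʳ_; [_]; head; last)
open import Data.List.Properties using (++-assoc)
open import Data.List.Relation.Unary.All using ([])
import Data.List.Relation.Unary.All.Properties as All
open import Data.List.Relation.Unary.AllPairs using ([]; _∷_)
open import Data.List.Relation.Unary.Any using (here; there)
open import Data.List.Relation.Unary.Unique.Propositional using (Unique)
import Data.List.Relation.Unary.Unique.Propositional.Properties as Unique
open import Data.List.Membership.Propositional using (_∈_; _∉_)
open import Data.List.Membership.Propositional.Properties using (∈-∃++)
open import Relation.Nullary using (yes; no)
open import Relation.Binary.Core using (Rel)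
open import Relation.Binary.PropositionalEquality
  using (_≡_; _≢_; refl; sym; trans; cong; subst; module ≡-Reasoning)
open import Relation.Binary.Construct.Closure.ReflexiveTransitive using (Star; ε; _◅_; gfold)

module _ {A : Set} where

  headOr : A → List A → A
  headOr d []      = d
  headOr d (x ∷ _) = x

  headOr-++-∷ : ∀ d xs y (ys : List A) → headOr d (xs ++ y ∷ ys) ≡ headOr y xs
  headOr-++-∷ d []      y ys = refl
  headOr-++-∷ d (_ ∷ _) y ys = refl

  head-∷ʳ : ∀ xs (x : A) → head (xs ∷ʳ x) ≡ just (headOr x xs)
  head-∷ʳ []      x = refl
  head-∷ʳ (_ ∷ _) x = refl

  head-++-∷ : ∀ xs (y : A) ys zs → head (xs ++ y ∷ ys) ≡ head (xs ++ y ∷ zs)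
  head-++-∷ []      y ys zs = refl
  head-++-∷ (_ ∷ _) y ys zs = refl

  last-++-∷ : ∀ xs (y : A) ys → last (xs ++ y ∷ ys) ≡ last (y ∷ ys)
  last-++-∷ []           y ys = refl
  last-++-∷ (_ ∷ [])     y ys = refl
  last-++-∷ (_ ∷ x ∷ xs) y ys = last-++-∷ (x ∷ xs) y ys

  Unique-++⁻ˡ : ∀ xs {ys : List A} → Unique (xs ++ ys) → Unique xs
  Unique-++⁻ˡ []       _          = []
  Unique-++⁻ˡ (_ ∷ xs) (x∉ ∷ xs!) = All.++⁻ˡ xs x∉ ∷ Unique-++⁻ˡ xs xs!

  Unique-∷ʳ⁺ : ∀ {xs} {x : A} → Unique xs → x ∉ xs → Unique (xs ∷ʳ x)
  Unique-∷ʳ⁺ xs! x∉xs = Unique.++⁺ xs! ([] ∷ []) λ { (x∈xs , here refl) → x∉xs x∈xs }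

  Unique-∷ʳ⁻ : ∀ {xs} {x : A} → Unique (xs ∷ʳ x) → x ∉ xs
  Unique-∷ʳ⁻ {_ ∷ _} (y≢ ∷ _)   (here refl) = proj₂ (All.∷ʳ⁻ y≢) refl
  Unique-∷ʳ⁻ {_ ∷ _} (_  ∷ xs!) (there x∈)  = Unique-∷ʳ⁻ xs! x∈

  Unique-∷ʳ-prefix : ∀ pre {z : A} {mid} → Unique (pre ++ z ∷ mid) → Unique (pre ∷ʳ z)
  Unique-∷ʳ-prefix pre {z} {mid} u =
    Unique-++⁻ˡ (pre ∷ʳ z) (subst Unique (sym (++-assoc pre [ z ] mid)) u)

  LEStep-head : ∀ {xs ys : List A} → LEStep xs ys → head xs ≡ head ys
  LEStep-head (erase pre y mid post _) = head-++-∷ pre y (mid ++ y ∷ post) post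

  LEStep-last : ∀ {xs ys : List A} → LEStep xs ys → last xs ≡ last ys
  LEStep-last (erase pre y mid post _) = begin
    last (pre ++ y ∷ mid ++ y ∷ post)  ≡⟨ last-++-∷ pre y _ ⟩
    last ((y ∷ mid) ++ y ∷ post)       ≡⟨ last-++-∷ (y ∷ mid) y post ⟩
    last (y ∷ post)                    ≡⟨ last-++-∷ pre y post ⟨
    last (pre ++ y ∷ post)             ∎
    where open ≡-Reasoning

Star-invariant : ∀ {ℓ} {I B : Set} {T : Rel I ℓ} (f : I → B) →
                 (∀ {i j} → T i j → f i ≡ f j) →
                 ∀ {i j} → Star T i j → f i ≡ f j
Star-invariant f inv = gfold f _≡_ (λ t eq → trans (inv t) eq) refl

i+1-1≡i : ∀ i → (i ℤ.+ + 1) ℤ.- + 1 ≡ i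
i+1-1≡i i = begin
  (i ℤ.+ + 1) ℤ.- + 1     ≡⟨ ℤ.+-assoc i (+ 1) (ℤ.- + 1) ⟩
  i ℤ.+ (+ 1 ℤ.- + 1)     ≡⟨ cong (λ j → i ℤ.+ j) (ℤ.+-inverseʳ (+ 1)) ⟩
  i ℤ.+ + 0               ≡⟨ ℤ.+-identityʳ i ⟩
  i                       ∎
  where open ≡-Reasoning

module Runs (S : Setting) where
  open Setting S
  open import Data.List.Membership.DecPropositional (_≟_ {n}) using (_∈?_)

  V : Set
  V = Vertex S

  pop-≢ : ∀ {x w} ρ i → w ≢ x → pop S x ρ w i ≡ ρ w i
  pop-≢ {x} {w} ρ i w≢x with w ≟ x
  ... | yes w≡x = ⊥-elim (w≢x w≡x)
  ... | no  _   = refl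

  pop-≡ : ∀ x ρ i → pop S x ρ x i ≡ ρ x (i ℤ.+ + 1)
  pop-≡ x ρ i with x ≟ x
  ... | yes _   = refl
  ... | no  x≢x = ⊥-elim (x≢x refl)

  push-≢ : ∀ {x w} ρ i → w ≢ x → push S x ρ w i ≡ ρ w i
  push-≢ {x} {w} ρ i w≢x with w ≟ x
  ... | yes w≡x = ⊥-elim (w≢x w≡x)
  ... | no  _   = refl

  push-≡ : ∀ x ρ i → push S x ρ x i ≡ ρ x (i ℤ.- + 1)
  push-≡ x ρ i with x ≟ x
  ... | yes _   = refl
  ... | no  x≢x = ⊥-elim (x≢x refl)

  target-≢ : ∀ {t w} → isT t ≡ true → InV₀ S w → w ≢ t
  target-≢ isT-t w∈V₀ refl with () ← trans (sym isT-t) w∈V₀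

  PRun-∷ : ∀ {ρ x p ρ′} → PRun S ρ x p ρ′ → ∃ λ p′ → p ≡ x ∷ p′
  PRun-∷ (stop _)   = _ , refl
  PRun-∷ (step _ _) = _ , refl

  data PointsAlong (ρ : Config S) : List V → V → Set where
    nil  : ∀ {x} → PointsAlong ρ [] x
    cons : ∀ {y ws x} → InV₀ S y → tgt (ρ y (+ 0)) ≡ headOr x ws →
           PointsAlong ρ ws x → PointsAlong ρ (y ∷ ws) x

  PointsAlong-resp : ∀ {ρ ρ′ ws t} x → (∀ {w} → w ≢ x → ρ′ w (+ 0) ≡ ρ w (+ 0)) →
                     x ∉ ws → PointsAlong ρ ws t → PointsAlong ρ′ ws t
  PointsAlong-resp x agree x∉ nil = nil
  PointsAlong-resp x agree x∉ (cons y∈V₀ e c) =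
    cons y∈V₀ (trans (cong tgt (agree λ { refl → x∉ (here refl) })) e)
         (PointsAlong-resp x agree (λ x∈ → x∉ (there x∈)) c)

  PointsAlong-∷ʳ : ∀ {ρ ws x z} → PointsAlong ρ ws x → InV₀ S x → tgt (ρ x (+ 0)) ≡ z →
                   PointsAlong ρ (ws ∷ʳ x) z
  PointsAlong-∷ʳ nil x∈V₀ e = cons x∈V₀ e nil
  PointsAlong-∷ʳ {z = z} (cons {ws = ws} {x} y∈V₀ e′ c) x∈V₀ e =
    cons y∈V₀ (trans e′ (sym (headOr-++-∷ z ws x []))) (PointsAlong-∷ʳ c x∈V₀ e)

  PointsAlong-prefix : ∀ {ρ x z mid} pre → PointsAlong ρ (pre ++ z ∷ mid) x → PointsAlong ρ pre z
  PointsAlong-prefix []        _ = nil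
  PointsAlong-prefix {x = x} {z} {mid} (_ ∷ pre) (cons y∈V₀ e c) =
    cons y∈V₀ (trans e (headOr-++-∷ x pre z mid)) (PointsAlong-prefix pre c)

  PointsAlong-pop-∷ʳ : ∀ {ρ ws v} → InV₀ S v → v ∉ ws → PointsAlong ρ ws v →
                       PointsAlong (pop S v ρ) (ws ∷ʳ v) (tgt (pop S v ρ v (+ 0)))
  PointsAlong-pop-∷ʳ {ρ} {v = v} v∈V₀ v∉ c =
    PointsAlong-∷ʳ (PointsAlong-resp v (λ w≢v → pop-≢ ρ (+ 0) w≢v) v∉ c) v∈V₀ refl

  record ErasedRun (ρ₁ : Config S) (walk : List V) : Set where
    field
      body   : List V
      target : V
      erases : Star LEStep walk (body ∷ʳ target)
      unique : Unique (body ∷ʳ target)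
      points : PointsAlong ρ₁ body target
      stops  : isT target ≡ true

  ErasedRun-◅ : ∀ {ρ₁ walk walk′} → LEStep walk walk′ → ErasedRun ρ₁ walk′ → ErasedRun ρ₁ walk
  ErasedRun-◅ s e = record
    { body = body ; target = target ; erases = s ◅ erases ; unique = unique ; points = points ; stops = stops }
    where open ErasedRun e

  ErasedRun-closeLoop :
    ∀ {ρ ρ₁ ws v z p} →
    (∀ hs → Unique (hs ∷ʳ z) → PointsAlong ρ hs z → ErasedRun ρ₁ (hs ++ z ∷ p)) →
    z ∈ ws ∷ʳ v → Unique (ws ∷ʳ v) → PointsAlong ρ (ws ∷ʳ v) z →
    ErasedRun ρ₁ (ws ++ v ∷ z ∷ p)
  ErasedRun-closeLoop {ρ} {ws = ws} {v} {z} {p} continue z∈ u c with ∈-∃++ z∈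
  ... | pre , mid , split =
    ErasedRun-◅ (subst (λ w → LEStep w (pre ++ z ∷ p)) (sym walk≡) (erase pre z mid p u′))
                (continue pre (Unique-∷ʳ-prefix pre u′)
                              (PointsAlong-prefix pre (subst (λ w → PointsAlong ρ w z) split c)))
    where
    u′ : Unique (pre ++ z ∷ mid)
    u′ = subst Unique split u

    walk≡ : ws ++ v ∷ z ∷ p ≡ pre ++ z ∷ mid ++ z ∷ p
    walk≡ = begin
      ws ++ v ∷ z ∷ p           ≡⟨ ++-assoc ws [ v ] (z ∷ p) ⟨
      (ws ∷ʳ v) ++ z ∷ p        ≡⟨ cong (_++ z ∷ p) split ⟩
      (pre ++ z ∷ mid) ++ z ∷ p ≡⟨ ++-assoc pre (z ∷ mid) (z ∷ p) ⟩
      pre ++ z ∷ mid ++ z ∷ p   ∎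
      where open ≡-Reasoning

  PRun⇒ErasedRun : ∀ {ρ x p ρ₁} → PRun S ρ x p ρ₁ →
                   ∀ ws → Unique (ws ∷ʳ x) → PointsAlong ρ ws x → ErasedRun ρ₁ (ws ++ p)
  PRun⇒ErasedRun {x = x} (stop isT-x) ws u c =
    record { body = ws ; target = x ; erases = ε ; unique = u ; points = c ; stops = isT-x }
  PRun⇒ErasedRun {ρ} {v} (step v∈V₀ run) ws u c
    with PRun-∷ run | PointsAlong-pop-∷ʳ v∈V₀ (Unique-∷ʳ⁻ u) c
  ... | p , refl | c′ with tgt (pop S v ρ v (+ 0)) ∈? ws ∷ʳ v
  ... | no  z∉ = subst (ErasedRun _) (++-assoc ws [ v ] _)
                       (PRun⇒ErasedRun run (ws ∷ʳ v) (Unique-∷ʳ⁺ u z∉) c′)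
  ... | yes z∈ = ErasedRun-closeLoop (PRun⇒ErasedRun run) z∈ u c′

  PushedAlong : List V → Config S → Config S → Set
  PushedAlong ws ρ σ = ∀ w i → (w ∈ ws → σ w i ≡ ρ w (i ℤ.- + 1)) × (w ∉ ws → σ w i ≡ ρ w i)

  PushedAlong-∷ : ∀ {y ws ρ σ} → y ∉ ws → PushedAlong ws (push S y ρ) σ → PushedAlong (y ∷ ws) ρ σ
  PushedAlong-∷ {y} {ρ = ρ} y∉ws pushed w i with w ≟ y
  ... | yes refl = (λ _ → trans (proj₂ (pushed w i) y∉ws) (push-≡ w ρ i))
                 , (λ w∉ → ⊥-elim (w∉ (here refl)))
  ... | no  w≢y  = (λ { (here w≡y) → ⊥-elim (w≢y w≡y)
                      ; (there w∈) → trans (proj₁ (pushed w i) w∈) (push-≢ ρ _ w≢y) })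
                 , (λ w∉ → trans (proj₂ (pushed w i) (λ w∈ → w∉ (there w∈))) (push-≢ ρ i w≢y))

  PushedAlong-pop : ∀ {y ws ρ σ} → y ∉ ws → PushedAlong (y ∷ ws) ρ σ → PushedAlong ws ρ (pop S y σ)
  PushedAlong-pop {y} {ρ = ρ} {σ} y∉ws pushed w i with w ≟ y
  ... | yes refl = (λ w∈ → ⊥-elim (y∉ws w∈))
                 , (λ _ → begin
                     σ w (i ℤ.+ + 1)            ≡⟨ proj₁ (pushed w (i ℤ.+ + 1)) (here refl) ⟩
                     ρ w ((i ℤ.+ + 1) ℤ.- + 1)  ≡⟨ cong (ρ w) (i+1-1≡i i) ⟩
                     ρ w i                      ∎)
    where open ≡-Reasoning
  ... | no  w≢y  = (λ w∈ → proj₁ (pushed w i) (there w∈))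
                 , (λ w∉ → proj₂ (pushed w i) λ { (here w≡y) → w≢y w≡y ; (there w∈) → w∉ w∈ })

  ARun-along : ∀ {ρ ws t} → PointsAlong ρ ws t → Unique ws → isT t ≡ true →
               Σ (Config S) λ ρ₂ → ARun S ρ (headOr t ws) (ws ∷ʳ t) ρ₂ × PushedAlong ws ρ ρ₂
  ARun-along {ρ} nil _ isT-t = ρ , stop isT-t , λ w i → (λ ()) , (λ _ → refl)
  ARun-along {ρ} (cons {y} {ws} {t} y∈V₀ e c) u@(_ ∷ ws!) isT-t =
    let ρ₂ , run , pushed = ARun-along (PointsAlong-resp y (push-≢ ρ (+ 0)) y∉ws c) ws! isT-t
    in  ρ₂ , step y∈V₀ (subst (λ x → ARun S (push S y ρ) x (ws ∷ʳ t) ρ₂) (sym e) run)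
           , PushedAlong-∷ y∉ws pushed
    where y∉ws = Unique.Unique[x∷xs]⇒x∉xs u

  PRun-pushed : ∀ {ρ σ ws t} → PointsAlong ρ ws t → Unique ws → isT t ≡ true → PushedAlong ws ρ σ →
                Σ (Config S) λ R → PRun S σ (headOr t ws) (ws ∷ʳ t) R × (∀ w i → R w i ≡ ρ w i)
  PRun-pushed {σ = σ} nil _ isT-t pushed = σ , stop isT-t , λ w i → proj₂ (pushed w i) λ ()
  PRun-pushed {ρ} {σ} (cons {y} {ws} {t} y∈V₀ e c) u@(_ ∷ ws!) isT-t pushed =
    let R , run , restored = PRun-pushed c ws! isT-t (PushedAlong-pop y∉ws pushed)
    in  R , step y∈V₀ (subst (λ x → PRun S (pop S y σ) x (ws ∷ʳ t) R) (sym popped) run) , restored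
    where
    y∉ws = Unique.Unique[x∷xs]⇒x∉xs u
    popped : tgt (pop S y σ y (+ 0)) ≡ headOr t ws
    popped = trans (cong tgt (trans (pop-≡ y σ (+ 0)) (proj₁ (pushed y (+ 1)) (here refl)))) e

  OneParticleAt : V → PConfig S → Set
  OneParticleAt x σ = ∀ w → InV₀ S w → (w ≡ x → σ w ≡ 1) × (w ≢ x → σ w ≡ 0)

  OneParticleAt-setAt : ∀ x → OneParticleAt x (setAt S x 1 (λ _ → 0))
  OneParticleAt-setAt x w _ with w ≟ x
  ... | yes w≡x = (λ _ → refl) , (λ w≢x → ⊥-elim (w≢x w≡x))
  ... | no  w≢x = (λ w≡x → ⊥-elim (w≢x w≡x)) , (λ _ → refl)

  OneParticleAt-move : ∀ {x σ} z → OneParticleAt x σ → OneParticleAt z (addOne S z (setAt S x 0 σ))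
  OneParticleAt-move {x} z one w w∈V₀ with w ≟ z
  ... | yes w≡z with w ≟ x
  ...   | yes _   = (λ _ → refl) , (λ w≢z → ⊥-elim (w≢z w≡z))
  ...   | no  w≢x = (λ _ → cong suc (proj₂ (one w w∈V₀) w≢x)) , (λ w≢z → ⊥-elim (w≢z w≡z))
  OneParticleAt-move {x} z one w w∈V₀ | no w≢z with w ≟ x
  ...   | yes _   = (λ w≡z → ⊥-elim (w≢z w≡z)) , (λ _ → refl)
  ...   | no  w≢x = (λ w≡z → ⊥-elim (w≢z w≡z)) , (λ _ → proj₂ (one w w∈V₀) w≢x)

  PRun⇒Fire : ∀ {ρ x p ρ′ σ} → PRun S ρ x p ρ′ → OneParticleAt x σ → Fire S σ ρ ρ′
  PRun⇒Fire (stop isT-x) one = done λ w w∈V₀ → proj₂ (one w w∈V₀) (target-≢ isT-x w∈V₀)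
  PRun⇒Fire {x = x} (step x∈V₀ run) one =
    step x 0 x∈V₀ (proj₁ (one x x∈V₀) refl) (PRun⇒Fire run (OneParticleAt-move _ one))

lemma4p6 : (S : Setting) → (ρ : Config S) → IsStackConfig S ρ →
           (v : Vertex S) → InV₀ S v →
           (p : List (Vertex S)) (ρ₁ : Config S) → PRun S ρ v p ρ₁ →
           Σ (List (Vertex S)) λ q → Σ (Config S) λ ρ₂ →
             ARun S ρ₁ v q ρ₂ × _≈ₛ_ S ρ₂ ρ × LoopErasure p q × last q ≡ last p
lemma4p6 S ρ _ v _ p ρ₁ run =
  let ρ₂ , antirun , pushed   = ARun-along points body! stops
      R  , rerun   , restored = PRun-pushed points body! stops pushed
  in  q , ρ₂ , subst (λ x → ARun S ρ₁ x q ρ₂) starts-at-v antirun ,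
      ( setAt S v 1 (λ _ → 0) , R , ρ₁
      , PRun⇒Fire (subst (λ x → PRun S ρ₂ x q R) starts-at-v rerun) (OneParticleAt-setAt v)
      , PRun⇒Fire run (OneParticleAt-setAt v)
      , λ w _ i → restored w i ) ,
      (erases , unique) , sym (Star-invariant last LEStep-last erases)
  where
  open Runs S
  open ErasedRun (PRun⇒ErasedRun run [] ([] ∷ []) nil)

  q : List V
  q = body ∷ʳ target

  body! : Unique body
  body! = Unique-++⁻ˡ body unique

  starts-at-v : headOr target body ≡ v
  starts-at-v = just-injective (begin
    just (headOr target body)  ≡⟨ head-∷ʳ body target ⟨
    head q                     ≡⟨ Star-invariant head LEStep-head erases ⟨
    head p                     ≡⟨ cong head (proj₂ (PRun-∷ run)) ⟩
    just v                     ∎)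
    where open ≡-Reasoning
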